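{- Fix a time domain $\mathbb{T}$ and a semantics $\psi$. Let $A$ be an algorithm relative to $\psi$ with finite set $T$ of critical terms, and for each state $X$ let $R^X$ be the rule defined below. Suppose $X,Y$ are states of $A$ and that $\mathrm{gen}(R^X,Z)=\mathrm{gen}(Z)$ for some state $Z$ isomorphic to $Y$. Then $\mathrm{gen}(R^X,Y)=\mathrm{gen}(Y)$.
   Context: Time: a set $\mathbb{T}$ with an associative binary operation $+$ having a neutral element $0$, and a total order $\le$ preserved by $+$. A timeline is a subset of $\mathbb{T}$ containing $0$; $\mathbb{I}$ is the set of timelines. A moment $i$ of a timeline $I$ is discrete if there is $t\in I$, $i<t$, with no $t'\in I$ strictly between; then $i^+$ is the smallest element of $I$ above $i$; otherwise $i$ is continuous. $I$ is non-Zeno if each $i\in I$ has only finitely many discrete $j\le i$ in $I$. Truncation: $I[i]=\{t\mid i+t\in I\}$. A dynamical system $\langle\mathcal{S},\mathcal{S}_0,\iota,\varphi\rangle$: a nonempty class $\mathcal{S}$ of states, nonempty subclass $\mathcal{S}_0$ of initial states, $\iota:\mathcal{S}\to\mathbb{I}$ with non-Zeno values, and $\varphi(X,i)\in\mathcal{S}$ for $X\in\mathcal{S}$, $i\in\iota(X)$, with $\varphi(X,0)=X$, $\iota(\varphi(X,i))=\iota(X)[i]$, $\varphi(X,i+i')=\varphi(\varphi(X,i),i')$ for $i,i+i'\in\iota(X)$. An abstract transition system is a dynamical system whose states are first-order structures over a finite vocabulary $\mathcal{V}$ such that: states and initial states are closed under isomorphism; $\varphi(X,i)$ has the same base set as $X$;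 if $\zeta: X\cong Y$ then $\iota(X)=\iota(Y)$ and $\zeta:\varphi(X,i)\cong\varphi(Y,i)$ for all $i\in\iota(X)$. Locations $(f,\bar a)$, updates $(f,\bar a,b)$; for $X,Y$ on the same base set, $Y\setminus X$ is the set of updates $(f,\bar a,f^Y(\bar a))$ with $f^Y(\bar a)\ne f^X(\bar a)$. $X$ is a jump if $0$ is discrete in $\iota(X)$, a flow otherwise; for a jump, $\Delta^+(X)=\varphi(X,0^+)\setminus X$. A semantics $\psi$ over a class of sets is a partial function mapping functions from a timeline into a set $S$ of the class to elements of $S$. A function on a timeline is initially constant if constant on $[0,t]$ for some $t>0$. For a state $X$ and location $(f,\bar a)$, $\mathrm{Evolution}(X,(f,\bar a))$ is $t\mapsto f^{\varphi(X,t)}(\bar a)$ for $t\in\iota(X)$, $0\le t\le I_1$ for some $I_1\in\iota(X)$ ($I_1=0^+$ for a jump), and $\psi[X,f,\bar a]$ is its image under $\psi$. When defined for all locations, $\Delta_\psi(X)$ is the set of updates $(f,\bar a,\psi[X,f,\bar a])$ over locations whose evolution is not initially constant; $\Delta_\psi$ is an infinitesimal generator, i.e. for an isomorphism $\zeta:X\cong Y$ of states, $(f,\bar a,b)\in\Delta_\psi(X)$ implies $(f,\zeta\bar a,\zeta b)\in\Delta_\psi(Y)$. The tagged generator is $\mathrm{gen}(X)=(\mathcal{F},\Delta_\psi(X))$ for a flow $X$ with $\Delta_\psi(X)$ defined and $(\mathcal{J},\Delta^+(X))$ for a jump $X$. An algorithm relative to $\psi$ is an abstract transition system with a finite set $T$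 of ground terms (critical terms) such that any two states $X,Y$ with $t^X=t^Y$ for all $t\in T$ both have tagged generators, and these are equal. A critical element of $X$ is a value $t^X$, $t\in T$. Rules and $\mathrm{gen}(R,X)$: update rule $f(t_1,\dots,t_j):=t_0$ gives $(\mathcal{J},\{(f,(t_1^X,\dots,t_j^X),t_0^X)\})$; $\texttt{par } R_1\dots R_k\texttt{ endpar}$ (update rules) gives $(\mathcal{J},\bigcup_i d_i)$ where $\mathrm{gen}(R_i,X)=(\mathcal{J},d_i)$; $\textsc{Dynamic}(f(t_1,\dots,t_j),t_0)$ gives $(\mathcal{F},\{(f,(t_1^X,\dots,t_j^X),t_0^X)\})$; $\texttt{flow } R_1\dots R_k\texttt{ endflow}$ (basic continuous rules) gives $(\mathcal{F},\bigcup_i d_i)$. The rule $R^X$: every entry of every update in $\mathrm{gen}(X)$ is a critical element of $X$. If $X$ is a jump, $R^X$ is the parallel rule consisting of one update rule $f(t_1,\dots,t_j):=t_0$ for each update $(f,(a_1,\dots,a_j),a_0)\in\Delta^+(X)$, where $t_0,\dots,t_j\in T$ are chosen with $t_i^X=a_i$; if $X$ is a flow, $R^X$ is the flow rule consisting of one rule $\textsc{Dynamic}(f(t_1,\dots,t_j),t_0)$ for each update $(f,(a_1,\dots,a_j),a_0)\in\Delta_\psi(X)$, with $t_0,\dots,t_j\in T$ chosen with $t_i^X=a_i$. Thus $\mathrm{gen}(R^X,X)=\mathrm{gen}(X)$. -}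

module Defs where

open import Level using (0ℓ)
open import Data.Nat using (ℕ)
open import Data.Fin using (Fin)
open import Data.Vec using (Vec; []; _∷_)
import Data.Vec as Vec
import Data.Vec.Relation.Unary.All as VAll
open import Data.List using (List)
import Data.List as List
open import Data.List.Membership.Propositional using (_∈_)
open import Data.List.Relation.Unary.All using (All)
open import Data.List.Relation.Unary.Unique.Propositional using (Unique)
open import Data.Product using (Σ; _×_; _,_; proj₁; proj₂)
open import Data.Sum using (_⊎_)
open import Relation.Nullary using (¬_)
open import Relation.Binary.PropositionalEquality using (_≡_; _≢_; subst)
open import Relation.Binary.Structures using (IsTotalOrder)
open import Function.Bundles using (_↔_; Inverse)

record TimeDomain : Set₁ where
  field
    𝕋 : Set
    _+_ : 𝕋 → 𝕋 → 𝕋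
    0# : 𝕋
    _≤_ : 𝕋 → 𝕋 → Set
    +-assoc : ∀ x y z → (x + y) + z ≡ x + (y + z)
    +-identityˡ : ∀ x → 0# + x ≡ x
    +-identityʳ : ∀ x → x + 0# ≡ x
    ≤-isTotalOrder : IsTotalOrder _≡_ _≤_
    +-monoˡ-≤ : ∀ {x y} z → x ≤ y → (x + z) ≤ (y + z)
    +-monoʳ-≤ : ∀ {x y} z → x ≤ y → (z + x) ≤ (z + y)

record Vocabulary : Set where
  field
    size : ℕ
    arity : Fin size → ℕ

module Theory (TD : TimeDomain) (V : Vocabulary) where
  open TimeDomain TD public
  open Vocabulary V public

  _<_ : 𝕋 → 𝕋 → Set
  x < y = (x ≤ y) × (x ≢ y)

  record Timeline : Set₁ where
    field
      mem : 𝕋 → Set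
      has0 : mem 0#
  open Timeline public

  _≐T_ : Timeline → Timeline → Set
  I ≐T J = ∀ t → (mem I t → mem J t) × (mem J t → mem I t)

  truncate : (I : Timeline) (i : 𝕋) → mem I i → Timeline
  truncate I i p = record
    { mem = λ t → mem I (i + t)
    ; has0 = subst (mem I) (Relation.Binary.PropositionalEquality.sym (+-identityʳ i)) p }

  Discrete : Timeline → 𝕋 → Set
  Discrete I i = Σ 𝕋 λ t → mem I t × i < t ×
                   ¬ (Σ 𝕋 λ t' → mem I t' × i < t' × t' < t)

  IsNext : Timeline → 𝕋 → 𝕋 → Set
  IsNext I i t = mem I t × i < t × (∀ t' → mem I t' → i < t' → t ≤ t')

  FiniteSubset : (𝕋 → Set) → Set
  FiniteSubset P = Σ (List 𝕋) λ xs → ∀ j → P j → j ∈ xs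

  NonZeno : Timeline → Set
  NonZeno I = ∀ i → mem I i →
    FiniteSubset (λ j → mem I j × Discrete I j × j ≤ i)

  Interp : Set → Set
  Interp A = (f : Fin size) → Vec A (arity f) → A

  record Structure : Set₁ where
    constructor mkStr
    field
      Carrier : Set
      interp : Interp Carrier
  open Structure public

  _≗I_ : {A : Set} → Interp A → Interp A → Set
  I ≗I J = ∀ f as → I f as ≡ J f as

  IsIso : {A B : Set} → A ↔ B → Interp A → Interp B → Set
  IsIso ζ I J = ∀ f as → Inverse.to ζ (I f as) ≡ J f (Vec.map (Inverse.to ζ) as)

  record _≅_ (X Y : Structure) : Set where
    field
      bij : Carrier X ↔ Carrier Y
      iso : IsIso bij (interp X) (interp Y)
  open _≅_ public

  record ATS : Set₁ where
    field
      IsState : Structure → Set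
      IsInitial : Structure → Set
      initial⇒state : ∀ {X} → IsInitial X → IsState X
      someInitial : Σ Structure IsInitial
      ι : (X : Structure) → IsState X → Timeline
      ι-nonZeno : ∀ X s → NonZeno (ι X s)
      φ : (X : Structure) (s : IsState X) (i : 𝕋) → mem (ι X s) i → Interp (Carrier X)
      φ-state : ∀ X s i p → IsState (mkStr (Carrier X) (φ X s i p))
      φ-zero : ∀ X s → φ X s 0# (has0 (ι X s)) ≗I interp X
      ι-φ : ∀ X s i p →
        ι (mkStr (Carrier X) (φ X s i p)) (φ-state X s i p) ≐T truncate (ι X s) i p
      φ-+ : ∀ X s i i' p q r →
        φ (mkStr (Carrier X) (φ X s i p)) (φ-state X s i p) i' q ≗I φ X s (i + i') r
      state-iso : ∀ {X Y} → X ≅ Y → IsState X → IsState Y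
      initial-iso : ∀ {X Y} → X ≅ Y → IsInitial X → IsInitial Y
      ι-iso : ∀ X Y s t → X ≅ Y → ι X s ≐T ι Y t
      φ-iso : ∀ X Y s t (ζ : X ≅ Y) i p q → IsIso (bij ζ) (φ X s i p) (φ Y t i q)
  open ATS public

  Update : Set → Set
  Update A = Σ (Fin size) λ f → Vec A (arity f) × A

  UpdSet : Set → Set₁
  UpdSet A = Update A → Set

  _≐U_ : {A : Set} → UpdSet A → UpdSet A → Set
  D ≐U E = ∀ u → (D u → E u) × (E u → D u)

  -- Y \ X for interpretations I (of X) and J (of Y) on the same base set.
  diff : {A : Set} → Interp A → Interp A → UpdSet A
  diff J I (f , as , b) = (b ≡ J f as) × (J f as ≢ I f as)

  -- Semantics: a partial function (as a functional relation) from functions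
  -- on a timeline into a set S to elements of S.

  record Semantics : Set₁ where
    field
      _↦_ : {S : Set} (J : Timeline) → (Σ 𝕋 (mem J) → S) → S → Set
      functional : ∀ {S J g} {b b' : S} → _↦_ J g b → _↦_ J g b' → b ≡ b'
  open Semantics public

  module _ (A : ATS) where
    Jump : (X : Structure) → IsState A X → Set
    Jump X s = Discrete (ι A X s) 0#

    Flow : (X : Structure) → IsState A X → Set
    Flow X s = ¬ Jump X s

    Δ⁺ : (X : Structure) (s : IsState A X) → UpdSet (Carrier X)
    Δ⁺ X s u = Σ 𝕋 λ t → Σ (mem (ι A X s) t) λ p →
                 IsNext (ι A X s) 0# t × diff (φ A X s t p) (interp X) u

    evo : (X : Structure) (s : IsState A X) (f : Fin size) → Vec (Carrier X) (arity f) →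
          (t : 𝕋) → mem (ι A X s) t → Carrier X
    evo X s f as t p = φ A X s t p f as

    InitiallyConstant : (I : Timeline) {S : Set} → ((t : 𝕋) → mem I t → S) → Set
    InitiallyConstant I g = Σ 𝕋 λ t → 0# < t ×
      (∀ t' (p : mem I t') → 0# ≤ t' → t' ≤ t → g t' p ≡ g 0# (has0 I))

    restrict : (I : Timeline) (I₁ : 𝕋) → 0# ≤ I₁ → Timeline
    restrict I I₁ h = record
      { mem = λ t → mem I t × 0# ≤ t × t ≤ I₁
      ; has0 = has0 I , IsTotalOrder.refl ≤-isTotalOrder , h }

    ψAt : Semantics → (X : Structure) (s : IsState A X) (f : Fin size) →
          Vec (Carrier X) (arity f) → Carrier X → Set
    ψAt ψ X s f as b = Σ 𝕋 λ I₁ → Σ (mem (ι A X s) I₁) λ p → Σ (0# < I₁) λ h →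
      (Jump X s → IsNext (ι A X s) 0# I₁) ×
      _↦_ ψ (restrict (ι A X s) I₁ (proj₁ h))
             (λ { (t , (q , _ , _)) → evo X s f as t q }) b

    DefinedΔ : Semantics → (X : Structure) → IsState A X → Set
    DefinedΔ ψ X s = ∀ f as → Σ (Carrier X) (ψAt ψ X s f as)

    Δψ : Semantics → (X : Structure) (s : IsState A X) → UpdSet (Carrier X)
    Δψ ψ X s (f , as , b) =
      ¬ InitiallyConstant (ι A X s) (evo X s f as) × ψAt ψ X s f as b

    InfinitesimalGenerator : Semantics → Set₁
    InfinitesimalGenerator ψ = ∀ X Y sX sY (ζ : X ≅ Y) →
      DefinedΔ ψ X sX → DefinedΔ ψ Y sY →
      ∀ f as b → Δψ ψ X sX (f , as , b) →
      Δψ ψ Y sY (f , Vec.map (Inverse.to (bij ζ)) as , Inverse.to (bij ζ) b)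

  data Tag : Set where
    𝓕 𝓙 : Tag

  TaggedGen : Set → Set₁
  TaggedGen A = Tag × UpdSet A

  -- gen(X) = g  (the tagged generator of X is defined and equals g)
  GenIs : (A : ATS) (ψ : Semantics) (X : Structure) → IsState A X →
          TaggedGen (Carrier X) → Set
  GenIs A ψ X s (tag , U) =
      (tag ≡ 𝓕 × Flow A X s × DefinedΔ A ψ X s × U ≐U Δψ A ψ X s)
    ⊎ (tag ≡ 𝓙 × Jump A X s × U ≐U Δ⁺ A X s)

  data Term : Set where
    app : (f : Fin size) → Vec Term (arity f) → Term

  mutual
    eval : (X : Structure) → Term → Carrier X
    eval X (app f ts) = interp X f (evalVec X ts)

    evalVec : (X : Structure) {k : ℕ} → Vec Term k → Vec (Carrier X) k
    evalVec X [] = []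
    evalVec X (t ∷ ts) = eval X t ∷ evalVec X ts

  record Algorithm (ψ : Semantics) : Set₁ where
    field
      ats : ATS
      T : List Term
      bounded : ∀ (B : Set) (I J : Interp B)
        (sI : IsState ats (mkStr B I)) (sJ : IsState ats (mkStr B J)) →
        (∀ t → t ∈ T → eval (mkStr B I) t ≡ eval (mkStr B J) t) →
        Σ (TaggedGen B) λ g → GenIs ats ψ (mkStr B I) sI g × GenIs ats ψ (mkStr B J) sJ g
  open Algorithm public

  -- f(t₁,…,tⱼ) := t₀   /   Dynamic(f(t₁,…,tⱼ), t₀)
  BasicRule : Set
  BasicRule = Σ (Fin size) λ f → Vec Term (arity f) × Term

  data Rule : Set where
    par  : List BasicRule → Rule   -- par of update rules
    flow : List BasicRule → Rule   -- flow of Dynamic rules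

  ruleUpd : (X : Structure) → BasicRule → Update (Carrier X)
  ruleUpd X (f , ts , t₀) = (f , evalVec X ts , eval X t₀)

  ruleUpds : (X : Structure) → List BasicRule → List (Update (Carrier X))
  ruleUpds X rs = List.map (ruleUpd X) rs

  genR : Rule → (X : Structure) → TaggedGen (Carrier X)
  genR (par rs) X = 𝓙 , λ u → u ∈ ruleUpds X rs
  genR (flow rs) X = 𝓕 , λ u → u ∈ ruleUpds X rs

  Matches : List Term → (X : Structure) → List BasicRule → UpdSet (Carrier X) → Set
  Matches T X rs D =
    All (λ { (f , ts , t₀) → VAll.All (_∈ T) ts × t₀ ∈ T }) rs ×
    Unique (ruleUpds X rs) ×
    (∀ u → (D u → u ∈ ruleUpds X rs) × (u ∈ ruleUpds X rs → D u))

  -- R is (a valid choice of) the rule R^X.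
  IsRX : {ψ : Semantics} (Alg : Algorithm ψ) (X : Structure) →
         IsState (ats Alg) X → Rule → Set
  IsRX {ψ} Alg X s R =
      (Jump (ats Alg) X s × Σ (List BasicRule) λ rs →
         R ≡ par rs × Matches (T Alg) X rs (Δ⁺ (ats Alg) X s))
    ⊎ (Flow (ats Alg) X s × DefinedΔ (ats Alg) ψ X s × Σ (List BasicRule) λ rs →
         R ≡ flow rs × Matches (T Alg) X rs (Δψ (ats Alg) ψ X s))

-- Everything in the tagged generator of a state is invariant under isomorphism:
-- the jump/flow dichotomy and Δ⁺ because an isomorphism commutes with φ and
-- preserves ι, Δψ because it is an infinitesimal generator, and the updates of
-- a rule because an isomorphism commutes with the evaluation of ground terms.
-- Hence gen(R, Y) and gen(Y) are the images under ζ of gen(R, Z) and gen(Z).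
module Submission where

open import Defs
open import Data.Vec using (Vec; []; _∷_)
import Data.Vec as Vec
open import Data.Vec.Properties using (map-∘; map-cong; map-id)
open import Data.List.Membership.Propositional using (_∈_)
open import Data.List.Membership.Propositional.Properties using (∈-map⁺; ∈-map⁻)
open import Data.Product using (_,_; proj₁; proj₂)
open import Data.Sum using (inj₁; inj₂)
open import Data.Empty using (⊥-elim)
open import Relation.Binary.PropositionalEquality
open import Function.Bundles using (Inverse; Injection)
open import Function.Properties.Inverse using (↔-sym; ↔⇒↣)

module _ (TD : TimeDomain) (V : Vocabulary) where
  open Theory TD V

  module _ {X Y : Structure} (ζ : X ≅ Y) where
    private
      to : Carrier X → Carrier Y
      to = Inverse.to (bij ζ)

      from : Carrier Y → Carrier X
      from = Inverse.from (bij ζ)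

    map-to-from : ∀ {k} (bs : Vec (Carrier Y) k) → Vec.map to (Vec.map from bs) ≡ bs
    map-to-from bs = begin
      Vec.map to (Vec.map from bs)   ≡⟨ map-∘ to from bs ⟨
      Vec.map (λ b → to (from b)) bs ≡⟨ map-cong (Inverse.strictlyInverseˡ (bij ζ)) bs ⟩
      Vec.map (λ b → b) bs           ≡⟨ map-id bs ⟩
      bs                             ∎
      where open ≡-Reasoning

    ≅-sym : Y ≅ X
    ≅-sym = record { bij = ↔-sym (bij ζ) ; iso = from-iso }
      where
      from-iso : ∀ f bs → from (interp Y f bs) ≡ interp X f (Vec.map from bs)
      from-iso f bs = Injection.injective (↔⇒↣ (bij ζ)) (begin
        to (from (interp Y f bs))                 ≡⟨ Inverse.strictlyInverseˡ (bij ζ) _ ⟩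
        interp Y f bs                             ≡⟨ cong (interp Y f) (map-to-from bs) ⟨
        interp Y f (Vec.map to (Vec.map from bs)) ≡⟨ iso ζ f (Vec.map from bs) ⟨
        to (interp X f (Vec.map from bs))         ∎)
        where open ≡-Reasoning

    mapUpdate : Update (Carrier X) → Update (Carrier Y)
    mapUpdate (f , as , b) = f , Vec.map to as , to b

    Preserves : UpdSet (Carrier X) → UpdSet (Carrier Y) → Set
    Preserves D E = ∀ u → D u → E (mapUpdate u)

    mutual
      eval-≅ : ∀ t → to (eval X t) ≡ eval Y t
      eval-≅ (app f ts) = trans (iso ζ f (evalVec X ts)) (cong (interp Y f) (evalVec-≅ ts))

      evalVec-≅ : ∀ {k} (ts : Vec Term k) → Vec.map to (evalVec X ts) ≡ evalVec Y ts
      evalVec-≅ []       = refl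
      evalVec-≅ (t ∷ ts) = cong₂ _∷_ (eval-≅ t) (evalVec-≅ ts)

    ruleUpds-preserved : ∀ rs → Preserves (_∈ ruleUpds X rs) (_∈ ruleUpds Y rs)
    ruleUpds-preserved rs u u∈ with ∈-map⁻ (ruleUpd X) u∈
    ... | (f , ts , t₀) , r∈ , refl =
      subst (_∈ ruleUpds Y rs)
        (sym (cong₂ (λ as b → f , as , b) (evalVec-≅ ts) (eval-≅ t₀)))
        (∈-map⁺ (ruleUpd Y) r∈)

  mapUpdate-≅-sym : ∀ {X Y} (ζ : X ≅ Y) u → mapUpdate ζ (mapUpdate (≅-sym ζ) u) ≡ u
  mapUpdate-≅-sym ζ (f , as , b) =
    cong₂ (λ as′ b′ → f , as′ , b′) (map-to-from ζ as) (Inverse.strictlyInverseˡ (bij ζ) b)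

  ≐U-transport : ∀ {X Y} (ζ : X ≅ Y) {D D′ : UpdSet (Carrier X)} {E E′ : UpdSet (Carrier Y)} →
    Preserves ζ D E → Preserves (≅-sym ζ) E D →
    Preserves ζ D′ E′ → Preserves (≅-sym ζ) E′ D′ →
    D ≐U D′ → E ≐U E′
  ≐U-transport ζ {E = E} {E′} D→E E→D D′→E′ E′→D′ D≐D′ u =
    (λ e → subst E′ (mapUpdate-≅-sym ζ u) (D′→E′ _ (proj₁ (D≐D′ _) (E→D u e)))) ,
    (λ e′ → subst E (mapUpdate-≅-sym ζ u) (D→E _ (proj₂ (D≐D′ _) (E′→D′ u e′))))

  Discrete-≐T : ∀ I J → I ≐T J → ∀ i → Discrete I i → Discrete J i
  Discrete-≐T _ _ I≐J i (t , t∈ , i<t , nothing-between) =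
    t , proj₁ (I≐J t) t∈ , i<t ,
    λ (t′ , t′∈ , i<t′ , t′<t) → nothing-between (t′ , proj₂ (I≐J t′) t′∈ , i<t′ , t′<t)

  IsNext-≐T : ∀ I J → I ≐T J → ∀ i t → IsNext I i t → IsNext J i t
  IsNext-≐T _ _ I≐J i t (t∈ , i<t , least) =
    proj₁ (I≐J t) t∈ , i<t , λ t′ t′∈ → least t′ (proj₂ (I≐J t′) t′∈)

  module _ (A : ATS) {X Y : Structure} (sX : IsState A X) (sY : IsState A Y) where

    Jump-≅ : X ≅ Y → Jump A X sX → Jump A Y sY
    Jump-≅ ζ = Discrete-≐T (ι A X sX) (ι A Y sY) (ι-iso A X Y sX sY ζ) 0#

    Δ⁺-preserved : (ζ : X ≅ Y) → Preserves ζ (Δ⁺ A X sX) (Δ⁺ A Y sY)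
    Δ⁺-preserved ζ (f , as , b) (t , t∈ , next , b≡ , changed) =
      t , t∈′ , IsNext-≐T (ι A X sX) (ι A Y sY) ιX≐ιY 0# t next ,
      trans (cong to b≡) φ-commutes ,
      λ unchanged → changed (Injection.injective (↔⇒↣ (bij ζ))
        (trans φ-commutes (trans unchanged (sym (iso ζ f as)))))
      where
      to : Carrier X → Carrier Y
      to = Inverse.to (bij ζ)

      ιX≐ιY : ι A X sX ≐T ι A Y sY
      ιX≐ιY = ι-iso A X Y sX sY ζ

      t∈′ : mem (ι A Y sY) t
      t∈′ = proj₁ (ιX≐ιY t) t∈

      φ-commutes : to (φ A X sX t t∈ f as) ≡ φ A Y sY t t∈′ f (Vec.map to as)
      φ-commutes = φ-iso A X Y sX sY ζ t t∈ t∈′ f as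

  Flow-≅ : (A : ATS) {X Y : Structure} (sX : IsState A X) (sY : IsState A Y) →
    X ≅ Y → Flow A X sX → Flow A Y sY
  Flow-≅ A sX sY ζ flowX jumpY = flowX (Jump-≅ A sY sX (≅-sym ζ) jumpY)

  -- Every state has a tagged generator, as seen by comparing it with itself.
  Flow⇒DefinedΔ : ∀ {ψ} (Alg : Algorithm ψ) {X} (sX : IsState (ats Alg) X) →
    Flow (ats Alg) X sX → DefinedΔ (ats Alg) ψ X sX
  Flow⇒DefinedΔ Alg {X} sX flowX
    with bounded Alg (Carrier X) (interp X) (interp X) sX sX (λ _ _ → refl)
  ... | _ , inj₁ (_ , _ , definedΔ , _) , _ = definedΔ
  ... | _ , inj₂ (_ , jumpX , _) , _        = ⊥-elim (flowX jumpX)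

  genR-≅ : ∀ {ψ} (Alg : Algorithm ψ) → InfinitesimalGenerator (ats Alg) ψ →
    ∀ {Y Z} (sY : IsState (ats Alg) Y) (sZ : IsState (ats Alg) Z) (R : Rule) →
    Z ≅ Y → GenIs (ats Alg) ψ Z sZ (genR R Z) → GenIs (ats Alg) ψ Y sY (genR R Y)
  genR-≅ Alg isGen sY sZ (par rs) ζ (inj₂ (refl , jumpZ , R≐Δ⁺)) =
    inj₂ (refl , Jump-≅ (ats Alg) sZ sY ζ jumpZ ,
          ≐U-transport ζ (ruleUpds-preserved ζ rs) (ruleUpds-preserved (≅-sym ζ) rs)
            (Δ⁺-preserved (ats Alg) sZ sY ζ) (Δ⁺-preserved (ats Alg) sY sZ (≅-sym ζ)) R≐Δ⁺)
  genR-≅ {ψ} Alg isGen {Y} {Z} sY sZ (flow rs) ζ (inj₁ (refl , flowZ , definedZ , R≐Δψ)) =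
    inj₁ (refl , flowY , definedY ,
          ≐U-transport ζ (ruleUpds-preserved ζ rs) (ruleUpds-preserved (≅-sym ζ) rs)
            (λ (f , as , b) → isGen Z Y sZ sY ζ definedZ definedY f as b)
            (λ (f , as , b) → isGen Y Z sY sZ (≅-sym ζ) definedY definedZ f as b)
            R≐Δψ)
    where
    flowY : Flow (ats Alg) Y sY
    flowY = Flow-≅ (ats Alg) sZ sY ζ flowZ
    definedY : DefinedΔ (ats Alg) ψ Y sY
    definedY = Flow⇒DefinedΔ Alg sY flowY

lemma4 : (TD : TimeDomain) (V : Vocabulary) →
    let open Theory TD V in
    (ψ : Semantics) (Alg : Algorithm ψ) →
    InfinitesimalGenerator (ats Alg) ψ →
    (X Y Z : Structure)
    (sX : IsState (ats Alg) X) (sY : IsState (ats Alg) Y) (sZ : IsState (ats Alg) Z)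
    (R : Rule) → IsRX Alg X sX R →
    Z ≅ Y →
    GenIs (ats Alg) ψ Z sZ (genR R Z) →
    GenIs (ats Alg) ψ Y sY (genR R Y)
lemma4 TD V ψ Alg isGen X Y Z sX sY sZ R _ = genR-≅ TD V Alg isGen sY sZ R
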